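{- For $n\ge2$, let $h'_n$ be the arbor whose root vertex contains one element and which has exactly one other vertex, a leaf containing $n-1$ elements. Then the cardinality of $P_{h'_n}$ is $\frac{3n-1}{n}\binom{2n-2}{n-1}$, which is the number of vertices of the $n$-dimensional halohedron $H_n$.
   Context: An arbor on a finite non-empty set $I$ is a rooted tree whose vertices are labeled by pairwise disjoint non-empty subsets of $I$ whose union is $I$; we identify a vertex with its label set. For a vertex $v$, $\mathscr{D}(v)$ is the union of the labels of all vertices whose path to the root passes through $v$ (including $v$). $P_t$ is the set of $a\in\mathbb{Z}^I$ with $a_i\ge0$ for all $i$ and $\sum_{i\in\mathscr{D}(v)}a_i\le|\mathscr{D}(v)|$ for every vertex $v$. (For $h'_n$: $a\in\mathbb{Z}_{\ge0}^n$ with the sum of the $n-1$ leaf coordinates at most $n-1$ and total sum at most $n$.) It is known that the $n$-dimensional halohedron has $\frac{3n-1}{n}\binom{2n-2}{n-1}$ vertices. -}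

module Defs where

open import Data.Nat using (ℕ; zero; suc; _+_; _≤_; _∸_)
open import Data.Vec using (Vec; []; _∷_; sum)
open import Data.Product using (Σ; _×_)
open import Data.Fin using (Fin)
open import Data.Empty using (⊥)
open import Function.Bundles using (_↔_)

-- The arbor h'_n on I = Fin n: root vertex {0}, one leaf {1,…,n-1}.
-- Points a ∈ ℤ^I with a_i ≥ 0 are represented as vectors of naturals.
-- Vertex conditions:  leaf: Σ_{i∈D(leaf)} a_i ≤ |D(leaf)| = n-1,
--                     root: Σ_{i∈I} a_i ≤ |I| = n.
InP-h' : (n : ℕ) → Vec ℕ n → Set
InP-h' zero [] = ⊥
InP-h' (suc m) (x ∷ xs) = (sum xs ≤ m) × (x + sum xs ≤ suc m)

P-h' : ℕ → Set
P-h' n = Σ (Vec ℕ n) (InP-h' n)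

HasCard : Set → ℕ → Set
HasCard A k = Fin k ↔ A

-- Splitting a point of P_{h'_n} (n = m + 1) on whether its root coordinate vanishes leaves the
-- leaf coordinates with sum at most m, either alone or together with the decremented root
-- coordinate.  By stars and bars this gives |P| = C(2m,m) + C(2m+1,m+1), and the absorption
-- identity (m+1) C(2m+1,m+1) = (2m+1) C(2m,m) turns n |P| into (3n-1) C(2m,m).
module Submission where

open import Defs
open import Data.Nat using (ℕ; _≤_; _*_; _∸_)
open import Data.Nat.Combinatorics using (_C_)
open import Data.Product using (Σ; _×_)
open import Relation.Binary.PropositionalEquality using (_≡_)

open import Data.Nat using (zero; suc; _+_; z≤n; s≤s)
open import Data.Nat.Properties
  using (+-suc; +-identityʳ; +-assoc; *-zeroʳ; *-identityˡ; *-identityʳ; *-distribˡ-+;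
         m≤n⇒m≤1+n; m+n≤o⇒n≤o; ≤-irrelevant)
open import Data.Nat.Combinatorics using (nCk+nC[k+1]≡[n+1]C[k+1]; nCn≡1; nC1≡n)
open import Data.Nat.Tactic.RingSolver using (solve-∀)
open import Data.Vec using (Vec; []; _∷_; sum)
open import Data.Product using (_,_)
open import Data.Sum using (_⊎_; inj₁; inj₂)
open import Data.Unit using (tt)
open import Data.Fin.Properties using (+↔⊎; 1↔⊤)
open import Data.Sum.Function.Propositional using (_⊎-↔_)
open import Function.Bundles using (_↔_; mk↔ₛ′)
open import Function.Properties.Inverse using (↔-trans; ↔-sym)
open import Relation.Binary.PropositionalEquality using (refl; cong; cong₂; sym; trans; subst; module ≡-Reasoning)

[k+1]*[n+1]C[k+1]≡[n+1]*nCk : ∀ n k → suc k * (suc n C suc k) ≡ suc n * (n C k)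
[k+1]*[n+1]C[k+1]≡[n+1]*nCk zero    zero    = refl
[k+1]*[n+1]C[k+1]≡[n+1]*nCk zero    (suc k) = *-zeroʳ (suc (suc k))
[k+1]*[n+1]C[k+1]≡[n+1]*nCk (suc n) zero    =
  trans (*-identityˡ _) (trans (nC1≡n (suc (suc n))) (sym (*-identityʳ (suc (suc n)))))
[k+1]*[n+1]C[k+1]≡[n+1]*nCk (suc n) (suc k) = begin
  suc (suc k) * (suc (suc n) C suc (suc k))
    ≡⟨ cong (suc (suc k) *_) (nCk+nC[k+1]≡[n+1]C[k+1] (suc n) (suc k)) ⟨
  suc (suc k) * (a + b)
    ≡⟨ *-distribˡ-+ (suc (suc k)) a b ⟩
  (a + suc k * a) + suc (suc k) * b
    ≡⟨ cong₂ (λ u v → (a + u) + v) ([k+1]*[n+1]C[k+1]≡[n+1]*nCk n k) ([k+1]*[n+1]C[k+1]≡[n+1]*nCk n (suc k)) ⟩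
  (a + suc n * (n C k)) + suc n * (n C suc k)
    ≡⟨ +-assoc a _ _ ⟩
  a + (suc n * (n C k) + suc n * (n C suc k))
    ≡⟨ cong (a +_) (*-distribˡ-+ (suc n) (n C k) (n C suc k)) ⟨
  a + suc n * (n C k + n C suc k)
    ≡⟨ cong (λ t → a + suc n * t) (nCk+nC[k+1]≡[n+1]C[k+1] n k) ⟩
  a + suc n * a
    ∎
  where
  open ≡-Reasoning
  a = suc n C suc k
  b = suc n C suc (suc k)

HasCard-⊎ : ∀ {A B : Set} {k l} → HasCard A k → HasCard B l → HasCard (A ⊎ B) (k + l)
HasCard-⊎ e f = ↔-trans +↔⊎ (e ⊎-↔ f)

HasCard-≡ : ∀ {A : Set} {k l} → k ≡ l → HasCard A k → HasCard A l
HasCard-≡ {A} = subst (HasCard A)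

SumAtMost : ℕ → ℕ → Set
SumAtMost m b = Σ (Vec ℕ m) (λ xs → sum xs ≤ b)

SumAtMost[0,b]-card : ∀ b → HasCard (SumAtMost 0 b) 1
SumAtMost[0,b]-card b =
  ↔-trans 1↔⊤ (mk↔ₛ′ (λ _ → [] , z≤n) (λ _ → tt) (λ { ([] , z≤n) → refl }) (λ _ → refl))

SumAtMost[1+m,0]↔SumAtMost[m,0] : ∀ m → SumAtMost (suc m) 0 ↔ SumAtMost m 0
SumAtMost[1+m,0]↔SumAtMost[m,0] m = mk↔ₛ′ to from (λ _ → refl) from∘to
  where
  to : SumAtMost (suc m) 0 → SumAtMost m 0
  to (zero ∷ xs , p) = xs , p
  from : SumAtMost m 0 → SumAtMost (suc m) 0
  from (xs , p) = zero ∷ xs , p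
  from∘to : ∀ v → from (to v) ≡ v
  from∘to (zero ∷ xs , p) = refl

SumAtMost-split : ∀ m b → SumAtMost (suc m) (suc b) ↔ (SumAtMost m (suc b) ⊎ SumAtMost (suc m) b)
SumAtMost-split m b = mk↔ₛ′ to from to∘from from∘to
  where
  to : SumAtMost (suc m) (suc b) → SumAtMost m (suc b) ⊎ SumAtMost (suc m) b
  to (zero  ∷ xs , p)     = inj₁ (xs , p)
  to (suc x ∷ xs , s≤s p) = inj₂ (x ∷ xs , p)
  from : SumAtMost m (suc b) ⊎ SumAtMost (suc m) b → SumAtMost (suc m) (suc b)
  from (inj₁ (xs , p))     = zero ∷ xs , p
  from (inj₂ (x ∷ xs , p)) = suc x ∷ xs , s≤s p
  to∘from : ∀ v → to (from v) ≡ v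
  to∘from (inj₁ (xs , p))     = refl
  to∘from (inj₂ (x ∷ xs , p)) = refl
  from∘to : ∀ v → from (to v) ≡ v
  from∘to (zero  ∷ xs , p)     = refl
  from∘to (suc x ∷ xs , s≤s p) = refl

SumAtMost-card : ∀ m b → HasCard (SumAtMost m b) ((b + m) C m)
SumAtMost-card zero    b       = SumAtMost[0,b]-card b
SumAtMost-card (suc m) zero    =
  ↔-trans (HasCard-≡ (trans (nCn≡1 m) (sym (nCn≡1 (suc m)))) (SumAtMost-card m zero))
          (↔-sym (SumAtMost[1+m,0]↔SumAtMost[m,0] m))
SumAtMost-card (suc m) (suc b) =
  ↔-trans (HasCard-≡ count (HasCard-⊎ (SumAtMost-card m (suc b)) (SumAtMost-card (suc m) b)))
          (↔-sym (SumAtMost-split m b))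
  where
  count : suc (b + m) C m + (b + suc m) C suc m ≡ suc (b + suc m) C suc m
  count = trans (cong (λ n → n C m + (b + suc m) C suc m) (sym (+-suc b m)))
                (nCk+nC[k+1]≡[n+1]C[k+1] (b + suc m) m)

P-h'-split : ∀ m → P-h' (suc m) ↔ (SumAtMost m m ⊎ SumAtMost (suc m) m)
P-h'-split m = mk↔ₛ′ to from to∘from from∘to
  where
  to : P-h' (suc m) → SumAtMost m m ⊎ SumAtMost (suc m) m
  to (zero  ∷ xs , (p , q))     = inj₁ (xs , p)
  to (suc x ∷ xs , (p , s≤s q)) = inj₂ (x ∷ xs , q)
  from : SumAtMost m m ⊎ SumAtMost (suc m) m → P-h' (suc m)
  from (inj₁ (xs , p))     = zero ∷ xs , (p , m≤n⇒m≤1+n p)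
  from (inj₂ (x ∷ xs , q)) = suc x ∷ xs , (m+n≤o⇒n≤o x q , s≤s q)
  to∘from : ∀ v → to (from v) ≡ v
  to∘from (inj₁ (xs , p))     = refl
  to∘from (inj₂ (x ∷ xs , q)) = refl
  from∘to : ∀ v → from (to v) ≡ v
  from∘to (zero  ∷ xs , (p , q))     = cong (λ r → zero ∷ xs , (p , r)) (≤-irrelevant _ _)
  from∘to (suc x ∷ xs , (p , s≤s q)) = cong (λ r → suc x ∷ xs , (r , s≤s q)) (≤-irrelevant _ _)

P-h'-card : ∀ m → HasCard (P-h' (suc m)) ((m + m) C m + (m + suc m) C suc m)
P-h'-card m = ↔-trans (HasCard-⊎ (SumAtMost-card m m) (SumAtMost-card (suc m) m)) (↔-sym (P-h'-split m))

[1+m][2mCm+[2m+1]C[1+m]]≡[3m+2]2mCm : ∀ m → suc m * ((m + m) C m + (m + suc m) C suc m) ≡ (3 * suc m ∸ 1) * ((m + m) C m)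
[1+m][2mCm+[2m+1]C[1+m]]≡[3m+2]2mCm m = begin
  suc m * (c + (m + suc m) C suc m)
    ≡⟨ *-distribˡ-+ (suc m) c _ ⟩
  suc m * c + suc m * ((m + suc m) C suc m)
    ≡⟨ cong (λ n → suc m * c + suc m * (n C suc m)) (+-suc m m) ⟩
  suc m * c + suc m * (suc (m + m) C suc m)
    ≡⟨ cong (suc m * c +_) ([k+1]*[n+1]C[k+1]≡[n+1]*nCk (m + m) m) ⟩
  suc m * c + suc (m + m) * c
    ≡⟨ coefficients m c ⟩
  (3 * suc m ∸ 1) * c
    ∎
  where
  open ≡-Reasoning
  c = (m + m) C m
  coefficients : ∀ x y → suc x * y + suc (x + x) * y ≡ (x + (suc x + (suc x + 0))) * y
  coefficients = solve-∀

2[1+m]∸2≡m+m : ∀ m → 2 * suc m ∸ 2 ≡ m + m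
2[1+m]∸2≡m+m m = trans (cong (_∸ 1) (+-suc m (m + 0))) (cong (m +_) (+-identityʳ m))

proposition8p2 : (n : ℕ) → 2 ≤ n →
    Σ ℕ (λ k → HasCard (P-h' n) k × (n * k ≡ (3 * n ∸ 1) * ((2 * n ∸ 2) C (n ∸ 1))))
proposition8p2 zero    ()
proposition8p2 (suc m) _ =
  (m + m) C m + (m + suc m) C suc m ,
  P-h'-card m ,
  trans ([1+m][2mCm+[2m+1]C[1+m]]≡[3m+2]2mCm m) (cong (λ t → (3 * suc m ∸ 1) * (t C m)) (sym (2[1+m]∸2≡m+m m)))
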